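{- Let $B_+^n$ be the set of tuples in $\{0,1\}^n$ having more than $n/2$ components equal to $1$, and let $\mathcal D:B_+^n\to\{0,1\}^n$ be the projection mapping. Then $\mathcal D$ is injective: for distinct $\tilde\alpha',\tilde\alpha''\in B_+^n$, $\mathcal D(\tilde\alpha')\ne\mathcal D(\tilde\alpha'')$.
   Context: Indices are cyclic modulo $n$. For $i,j\in\{1,\dots,n\}$ the segment $\tilde\alpha[i:j]$ is $(\alpha_i,\dots,\alpha_j)$ if $i\le j$ and $(\alpha_i,\dots,\alpha_n,\alpha_1,\dots,\alpha_j)$ if $i>j$. Its prefixes are the segments $\tilde\alpha[i:j']$ with $j'$ strictly before $j$ in the cyclic traversal from $i$. A segment is balanced / $0$-dominated if its number of zeros is equal to / greater than its number of ones. A minimal balanced segment is a balanced segment every prefix of which is $0$-dominated. A component $\alpha_i=0$ and a component $\alpha_j=1$ are connected if $\tilde\alpha[i:j]$ is a minimal balanced segment. A component is bound if it is connected to some component, unbound otherwise. For $\tilde\alpha\in B_+^n$ (which always has an unbound component equal to $1$), $\mathcal D(\tilde\alpha)$ is obtained from $\tilde\alpha$ by replacing with $0$ the unbound component equal to $1$ having the largest index. -}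

module Defs where

open import Data.Bool using (Bool; true; false; _∧_; _∨_; not; if_then_else_)
open import Data.Nat using (ℕ; zero; suc; _+_; _*_; _∸_; _<_; _<ᵇ_; _≡ᵇ_; _%_)
open import Data.Nat.DivMod using (m%n<n)
open import Data.Fin using (Fin; toℕ; fromℕ<)
open import Data.Vec using (Vec; lookup; tabulate; toList)
open import Data.List using (List; []; _∷_; map; upTo; allFin)
open import Data.Bool.ListAction using (and; or)
open import Relation.Nullary.Decidable using (Dec)

-- Binary n-tuples; positions 1..n of the paper are Fin n (0-based here).
Tuple : ℕ → Set
Tuple n = Vec Bool n   -- true = component 1, false = component 0

ones : List Bool → ℕ
ones [] = 0
ones (true ∷ bs) = suc (ones bs)
ones (false ∷ bs) = ones bs
zeros : List Bool → ℕ
zeros [] = 0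
zeros (true ∷ bs) = zeros bs
zeros (false ∷ bs) = suc (zeros bs)

InBplus : ∀ {n} → Tuple n → Set
InBplus {n} α = n < 2 * ones (toList α)

at : ∀ {n} → Tuple n → ℕ → Bool
at {zero} α k = false
at {suc m} α k = lookup α (fromℕ< (m%n<n k (suc m)))

seg : ∀ {n} → Tuple n → ℕ → ℕ → List Bool
seg α i L = map (λ k → at α (i + k)) (upTo L)

-- length of the segment α[i:j] (from i cyclically to j, inclusive)
segLen : (n i j : ℕ) → ℕ
segLen zero i j = 1
segLen (suc m) i j = suc ((j + suc m ∸ i) % suc m)

balancedᵇ : List Bool → Bool
balancedᵇ s = zeros s ≡ᵇ ones s

zeroDomᵇ : List Bool → Bool
zeroDomᵇ s = ones s <ᵇ zeros s

-- minimal balanced segment: balanced, and every proper prefix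
-- (lengths 1 .. L-1) is 0-dominated
minBalᵇ : ∀ {n} → Tuple n → ℕ → ℕ → Bool
minBalᵇ α i L = balancedᵇ (seg α i L)
               ∧ and (map (λ l → zeroDomᵇ (seg α i (suc l))) (upTo (L ∸ 1)))

connectedᵇ : ∀ {n} → Tuple n → Fin n → Fin n → Bool
connectedᵇ {n} α i j =
  not (lookup α i) ∧ lookup α j ∧ minBalᵇ α (toℕ i) (segLen n (toℕ i) (toℕ j))

boundᵇ : ∀ {n} → Tuple n → Fin n → Bool
boundᵇ {n} α k = or (map (λ j → connectedᵇ α k j ∨ connectedᵇ α j k) (allFin n))

unboundOneᵇ : ∀ {n} → Tuple n → Fin n → Bool
unboundOneᵇ α k = lookup α k ∧ not (boundᵇ α k)

lastUnboundOneᵇ : ∀ {n} → Tuple n → Fin n → Bool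
lastUnboundOneᵇ {n} α k =
  unboundOneᵇ α k
  ∧ and (map (λ j → not ((toℕ k <ᵇ toℕ j) ∧ unboundOneᵇ α j)) (allFin n))

D : ∀ {n} → Tuple n → Tuple n
D α = tabulate (λ k → lookup α k ∧ not (lastUnboundOneᵇ α k))

module Submission where

open import Defs
open import Data.Bool using (Bool; true; false; T; not; _∧_)
open import Data.Bool.Properties using (T-∧; T-∨; T-≡; T-not-≡; ∧-zeroʳ; ∧-identityʳ)
open import Data.Nat as ℕ using (ℕ; zero; suc; _+_; _*_; _∸_; _%_; _≤_; _<_; z≤n; s≤s; z<s; s<s)
import Data.Nat.Properties as ℕP
open import Data.Nat.DivMod using ([m+n]%n≡m%n; m<n⇒m%n≡m)
open import Data.Nat.Tactic.RingSolver using (solve-∀)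
open import Data.Integer as ℤ using (ℤ; +0; +[1+_]; -[1+_]; _⊖_; 0ℤ; 1ℤ; -1ℤ; +<+; -<+; +≤+; -≤+)
  renaming (_+_ to _+ᶻ_; _<_ to _<ᶻ_; _≤_ to _≤ᶻ_)
import Data.Integer.Properties as ℤP
open import Data.Fin as F using (Fin; toℕ; fromℕ<)
import Data.Fin.Properties as FP
open import Data.Vec as V using (Vec; lookup; toList; tabulate)
open import Data.Vec.Properties using (lookup∘tabulate; tabulate∘lookup; tabulate-cong; length-toList)
open import Data.List as L using (List; []; _∷_; applyUpTo; allFin)
import Data.List.Properties as LP
import Data.List.Relation.Unary.All as All
import Data.List.Relation.Unary.Any as Any
open import Data.List.Relation.Unary.All.Properties using (all⁺; all⁻; applyUpTo⁺₁)
open import Data.List.Relation.Unary.Any.Properties using (any⁺; any⁻)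
open import Data.List.Membership.Propositional.Properties using (∈-allFin)
open import Function using (_∘_; Equivalence)
open import Data.Product using (∃; _×_; _,_; proj₁; proj₂)
open import Data.Sum using (_⊎_; inj₁; inj₂; [_,_]′)
open import Data.Empty using (⊥; ⊥-elim)
open import Relation.Nullary using (¬_; yes; no)
open import Relation.Nullary.Decidable using (T?)
open import Relation.Binary.PropositionalEquality
open import Relation.Binary.Definitions using (tri<; tri≈; tri>)

-- Read a 0/1-sequence as a walk in which a zero steps up and a one steps down; the
-- height of a segment is its number of zeros minus its number of ones.  A balanced
-- segment is minimal iff its proper prefixes have positive height, equivalently iff
-- its proper suffixes have negative height.  A one at position k is unbound iff every
-- cyclic segment of length at most n ending at k has negative height (scan backward
-- from k); a full turn of a tuple of B₊ has negative height, which produces unbound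
-- ones (ending a first lowest prefix), hence a last one, the position D clears.
-- If D α′ = D α″ with α′ ≠ α″, the cleared positions differ, say p < q.  Then α″ has a
-- zero at p and agrees with α′ strictly between p and q.  Scanning α″ forward from p,
-- the zero at p is connected to a one at some j with p < j < q, and every segment of
-- α′ ending at j has negative height, so j is an unbound one of α′ after its last one.

+-right-comm : ∀ x y z → x + y + z ≡ x + z + y
+-right-comm = solve-∀

v : Bool → ℤ
v true  = -1ℤ
v false = 1ℤ

height : (ℕ → Bool) → ℕ → ℕ → ℤ
height f s zero    = 0ℤ
height f s (suc L) = v (f s) +ᶻ height f (suc s) L

height-cong : ∀ f g s t L → (∀ k → k < L → f (s + k) ≡ g (t + k)) →
              height f s L ≡ height g t L
height-cong f g s t zero    agree = refl
height-cong f g s t (suc L) agree = cong₂ _+ᶻ_ (cong v first) (height-cong f g (suc s) (suc t) L rest)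
  where
  first : f s ≡ g t
  first = subst₂ (λ a b → f a ≡ g b) (ℕP.+-identityʳ s) (ℕP.+-identityʳ t) (agree 0 z<s)
  rest : ∀ k → k < L → f (suc s + k) ≡ g (suc t + k)
  rest k k<L = subst₂ (λ a b → f a ≡ g b) (ℕP.+-suc s k) (ℕP.+-suc t k) (agree (suc k) (s<s k<L))

height-++ : ∀ f s a b → height f s (a + b) ≡ height f s a +ᶻ height f (s + a) b
height-++ f s zero    b =
  trans (cong (λ x → height f x b) (sym (ℕP.+-identityʳ s))) (sym (ℤP.+-identityˡ _))
height-++ f s (suc a) b = begin
  v (f s) +ᶻ height f (suc s) (a + b)
    ≡⟨ cong (v (f s) +ᶻ_) (height-++ f (suc s) a b) ⟩
  v (f s) +ᶻ (height f (suc s) a +ᶻ height f (suc s + a) b)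
    ≡⟨ sym (ℤP.+-assoc (v (f s)) _ _) ⟩
  height f s (suc a) +ᶻ height f (suc s + a) b
    ≡⟨ cong (λ x → height f s (suc a) +ᶻ height f x b) (sym (ℕP.+-suc s a)) ⟩
  height f s (suc a) +ᶻ height f (s + suc a) b
    ∎
  where open ≡-Reasoning

height-snoc : ∀ f s a → height f s (suc a) ≡ height f s a +ᶻ v (f (s + a))
height-snoc f s a = begin
  height f s (suc a)                      ≡⟨ cong (height f s) (ℕP.+-comm 1 a) ⟩
  height f s (a + 1)                      ≡⟨ height-++ f s a 1 ⟩
  height f s a +ᶻ (v (f (s + a)) +ᶻ 0ℤ)  ≡⟨ cong (height f s a +ᶻ_) (ℤP.+-identityʳ _) ⟩
  height f s a +ᶻ v (f (s + a))           ∎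
  where open ≡-Reasoning

letter-unbalanced : ∀ b → v b +ᶻ 0ℤ ≢ 0ℤ
letter-unbalanced true  ()
letter-unbalanced false ()

positive-letter : ∀ b → 0ℤ <ᶻ v b +ᶻ 0ℤ → b ≡ false
positive-letter false _ = refl
positive-letter true  ()

negative-letter : ∀ b → v b +ᶻ 0ℤ <ᶻ 0ℤ → b ≡ true
negative-letter true  _ = refl
negative-letter false (+<+ ())

-- One letter changes a height by at most one: appended to a positive height it
-- leaves it at least zero.
append-to-positive : ∀ a b → 0ℤ <ᶻ a → 0ℤ ≤ᶻ a +ᶻ v b
append-to-positive +[1+ n ] true  _ = +≤+ z≤n
append-to-positive +[1+ n ] false _ = +≤+ z≤n
append-to-positive +0 b (+<+ ())

prepend-to-negative : ∀ b a → a <ᶻ 0ℤ → v b +ᶻ a ≤ᶻ 0ℤ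
prepend-to-negative true  -[1+ n ] _ = -≤+
prepend-to-negative false -[1+ zero ]  _ = +≤+ z≤n
prepend-to-negative false -[1+ suc n ] _ = -≤+
prepend-to-negative b     (ℤ.+ n) (+<+ ())

drop⇒negative : ∀ a b → a +ᶻ b <ᶻ a → b <ᶻ 0ℤ
drop⇒negative a b a+b<a with b ℤP.<? 0ℤ
... | yes b<0 = b<0
... | no  b≮0 = ⊥-elim (ℤP.<⇒≱ a+b<a
                  (subst (_≤ᶻ a +ᶻ b) (ℤP.+-identityʳ a) (ℤP.+-monoʳ-≤ a (ℤP.≮⇒≥ b≮0))))

letter-lowers : ∀ a b → a +ᶻ v b <ᶻ a → b ≡ true
letter-lowers a true  _     = refl
letter-lowers a false a+1<a with drop⇒negative a 1ℤ a+1<a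
... | +<+ ()

balanced-left : ∀ a b → a +ᶻ b ≡ 0ℤ → 0ℤ <ᶻ a → b <ᶻ 0ℤ
balanced-left a b a+b≡0 0<a = drop⇒negative a b (subst (_<ᶻ a) (sym a+b≡0) 0<a)

balanced-right : ∀ a b → a +ᶻ b ≡ 0ℤ → b <ᶻ 0ℤ → 0ℤ <ᶻ a
balanced-right a b a+b≡0 b<0 with 0ℤ ℤP.<? a
... | yes 0<a = 0<a
... | no  0≮a = ⊥-elim (ℤP.<-irrefl a+b≡0 (ℤP.+-mono-≤-< (ℤP.≮⇒≥ 0≮a) b<0))

Balanced : (ℕ → Bool) → ℕ → ℕ → Set
Balanced f x j = height f x (suc j) ≡ 0ℤ

ZeroDominatedPrefixes : (ℕ → Bool) → ℕ → ℕ → Set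
ZeroDominatedPrefixes f x j = ∀ l → l < j → 0ℤ <ᶻ height f x (suc l)

OneDominatedSuffixes : (ℕ → Bool) → ℕ → ℕ → Set
OneDominatedSuffixes f x j = ∀ l e → l + suc e ≡ j → height f (x + suc l) (suc e) <ᶻ 0ℤ

proper-cut : ∀ {l j} → l < j → ∃ λ e → l + suc e ≡ j
proper-cut {l} l<j with ℕP.m≤n⇒∃[o]m+o≡n l<j
... | o , 1+l+o≡j = o , trans (ℕP.+-suc l o) 1+l+o≡j

-- For a balanced segment the two minimality conditions are equivalent, since
-- the heights of a prefix and of the complementary suffix add up to zero.
prefixes⇒suffixes : ∀ {f x j} → Balanced f x j → ZeroDominatedPrefixes f x j → OneDominatedSuffixes f x j
prefixes⇒suffixes {f} {x} balanced prefixes l e refl =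
  balanced-left _ _ (trans (sym (height-++ f x (suc l) (suc e))) balanced) (prefixes l (ℕP.m<m+n l z<s))

suffixes⇒prefixes : ∀ {f x j} → Balanced f x j → OneDominatedSuffixes f x j → ZeroDominatedPrefixes f x j
suffixes⇒prefixes {f} {x} balanced suffixes l l<j with proper-cut l<j
... | e , refl = balanced-right _ _ (trans (sym (height-++ f x (suc l) (suc e))) balanced) (suffixes l e refl)

-- A segment with 0-dominated proper prefixes starts with a zero, its first letter
-- being such a prefix.
starts-with-zero : ∀ {f x t} → ZeroDominatedPrefixes f x (suc t) → f x ≡ false
starts-with-zero {f} {x} prefixes = positive-letter (f x) (prefixes 0 z<s)

-- A segment with 1-dominated proper suffixes ends with a one, its last letter
-- being such a suffix.
ends-with-one : ∀ {f x t} → OneDominatedSuffixes f x (suc t) → f (x + suc t) ≡ true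
ends-with-one {f} {x} {t} suffixes = negative-letter (f (x + suc t)) (suffixes t 0 (ℕP.+-comm t 1))

after-first-letter : ∀ {f x t} → OneDominatedSuffixes f x t → height f (suc x) t ≤ᶻ 0ℤ
after-first-letter {t = zero}  _        = ℤP.≤-refl
after-first-letter {f} {x} {suc e} suffixes =
  ℤP.<⇒≤ (subst (λ y → height f y (suc e) <ᶻ 0ℤ) (ℕP.+-comm x 1) (suffixes 0 e refl))

suffixes-transfer : ∀ f g x j → (∀ y → x < y → y ≤ x + j → f y ≡ g y) →
                    OneDominatedSuffixes f x j → OneDominatedSuffixes g x j
suffixes-transfer f g x j agree suffixes l e l+1+e≡j =
  subst (_<ᶻ 0ℤ) (height-cong f g _ _ (suc e) inside) (suffixes l e l+1+e≡j)
  where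
  inside : ∀ k → k < suc e → f (x + suc l + k) ≡ g (x + suc l + k)
  inside k k<1+e = agree _ (ℕP.<-≤-trans (ℕP.m<m+n x z<s) (ℕP.m≤m+n (x + suc l) k)) (begin
    x + suc l + k    ≡⟨ ℕP.+-assoc x (suc l) k ⟩
    x + (suc l + k)  ≡⟨ cong (x +_) (sym (ℕP.+-suc l k)) ⟩
    x + (l + suc k)  ≤⟨ ℕP.+-monoʳ-≤ x (ℕP.+-monoʳ-≤ l k<1+e) ⟩
    x + (l + suc e)  ≡⟨ cong (x +_) l+1+e≡j ⟩
    x + j            ∎)
    where open ℕP.≤-Reasoning

forward-scan : ∀ f x n → f x ≡ false →
  (∀ j → j ≤ n → Balanced f x j → ZeroDominatedPrefixes f x j → ⊥) →
  ∀ l → l ≤ n → 0ℤ <ᶻ height f x (suc l)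
forward-scan f x zero fx _ zero z≤n rewrite fx = +<+ z<s
forward-scan f x (suc n) fx none l l≤1+n =
  [ (λ l<1+n → shorter l (ℕ.s≤s⁻¹ l<1+n))
  , (λ l≡1+n → subst (λ l → 0ℤ <ᶻ height f x (suc l)) (sym l≡1+n) longest)
  ]′ (ℕP.m≤n⇒m<n∨m≡n l≤1+n)
  where
  shorter : ∀ l → l ≤ n → 0ℤ <ᶻ height f x (suc l)
  shorter = forward-scan f x n fx (λ j j≤n → none j (ℕP.m≤n⇒m≤1+n j≤n))
  prefixes : ZeroDominatedPrefixes f x (suc n)
  prefixes l l<1+n = shorter l (ℕ.s≤s⁻¹ l<1+n)
  nonnegative : 0ℤ ≤ᶻ height f x (suc (suc n))
  nonnegative = subst (0ℤ ≤ᶻ_) (sym (height-snoc f x (suc n))) (append-to-positive _ _ (shorter n ℕP.≤-refl))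
  longest : 0ℤ <ᶻ height f x (suc (suc n))
  longest = ℤP.≤∧≢⇒< nonnegative (λ 0≡h → none (suc n) ℕP.≤-refl (sym 0≡h) prefixes)

backward-scan : ∀ f z n → f z ≡ true →
  (∀ y e → y + e ≡ z → e ≤ n → Balanced f y e → OneDominatedSuffixes f y e → ⊥) →
  ∀ y r → y + r ≡ z → r ≤ n → height f y (suc r) <ᶻ 0ℤ
backward-scan f z zero fz _ y zero y+0≡z z≤n
  rewrite trans (cong f (trans (sym (ℕP.+-identityʳ y)) y+0≡z)) fz = -<+
backward-scan f z (suc n) fz none y r y+r≡z r≤1+n =
  [ (λ r<1+n → shorter y r y+r≡z (ℕ.s≤s⁻¹ r<1+n))
  , (λ r≡1+n → subst (λ r → height f y (suc r) <ᶻ 0ℤ) (sym r≡1+n) (longest (subst (λ r → y + r ≡ z) r≡1+n y+r≡z)))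
  ]′ (ℕP.m≤n⇒m<n∨m≡n r≤1+n)
  where
  shorter : ∀ y r → y + r ≡ z → r ≤ n → height f y (suc r) <ᶻ 0ℤ
  shorter = backward-scan f z n fz (λ y e y+e≡z e≤n → none y e y+e≡z (ℕP.m≤n⇒m≤1+n e≤n))
  suffixes : y + suc n ≡ z → OneDominatedSuffixes f y (suc n)
  suffixes y+1+n≡z l e l+1+e≡1+n =
    shorter (y + suc l) e reaches-z (ℕ.s≤s⁻¹ (subst (suc e ≤_) l+1+e≡1+n (ℕP.m≤n+m (suc e) l)))
    where
    reaches-z : y + suc l + e ≡ z
    reaches-z = begin
      y + suc l + e    ≡⟨ ℕP.+-assoc y (suc l) e ⟩
      y + suc (l + e)  ≡⟨ cong (y +_) (sym (ℕP.+-suc l e)) ⟩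
      y + (l + suc e)  ≡⟨ cong (y +_) l+1+e≡1+n ⟩
      y + suc n        ≡⟨ y+1+n≡z ⟩
      z                ∎
      where open ≡-Reasoning
  longest : y + suc n ≡ z → height f y (suc (suc n)) <ᶻ 0ℤ
  longest y+1+n≡z = ℤP.≤∧≢⇒< nonpositive (λ h≡0 → none y (suc n) y+1+n≡z ℕP.≤-refl h≡0 (suffixes y+1+n≡z))
    where
    nonpositive : height f y (suc (suc n)) ≤ᶻ 0ℤ
    nonpositive = prepend-to-negative (f y) _ (shorter (suc y) n (trans (sym (ℕP.+-suc y n)) y+1+n≡z) ℕP.≤-refl)

T-not-intro : ∀ b → ¬ T b → T (not b)
T-not-intro true  ¬b = ¬b _
T-not-intro false _  = _

T-not-elim : ∀ b → T (not b) → ¬ T b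
T-not-elim true  () _
T-not-elim false _  ()

imbalance : List Bool → ℤ
imbalance w = zeros w ⊖ ones w

imbalance-∷ : ∀ b w → imbalance (b ∷ w) ≡ v b +ᶻ imbalance w
imbalance-∷ true  w = sym (ℤP.distribʳ-⊖-+-neg 0 (zeros w) (ones w))
imbalance-∷ false w = sym (ℤP.distribʳ-⊖-+-pos 1 (zeros w) (ones w))

imbalance-applyUpTo : ∀ f s g L → (∀ k → g k ≡ f (s + k)) → imbalance (applyUpTo g L) ≡ height f s L
imbalance-applyUpTo f s g zero    _   = refl
imbalance-applyUpTo f s g (suc L) g≗f = begin
  imbalance (g 0 ∷ applyUpTo (g ∘ suc) L)       ≡⟨ imbalance-∷ (g 0) _ ⟩
  v (g 0) +ᶻ imbalance (applyUpTo (g ∘ suc) L)  ≡⟨ cong₂ _+ᶻ_ (cong v first) rest ⟩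
  height f s (suc L)                            ∎
  where
  open ≡-Reasoning
  first : g 0 ≡ f s
  first = trans (g≗f 0) (cong f (ℕP.+-identityʳ s))
  rest : imbalance (applyUpTo (g ∘ suc) L) ≡ height f (suc s) L
  rest = imbalance-applyUpTo f (suc s) (g ∘ suc) L (λ k → trans (g≗f (suc k)) (cong f (ℕP.+-suc s k)))

imbalance-seg : ∀ {n} (α : Tuple n) i L → imbalance (seg α i L) ≡ height (at α) i L
imbalance-seg α i L = trans (cong imbalance (LP.map-upTo _ L)) (imbalance-applyUpTo (at α) i _ L (λ _ → refl))

imbalance-toList : ∀ {n} (w : Vec Bool n) f s → (∀ i → lookup w i ≡ f (s + toℕ i)) →
                   imbalance (toList w) ≡ height f s n
imbalance-toList V.[]      f s _     = refl
imbalance-toList {suc n} (b V.∷ w) f s w≗f = begin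
  imbalance (b ∷ toList w)       ≡⟨ imbalance-∷ b (toList w) ⟩
  v b +ᶻ imbalance (toList w)    ≡⟨ cong₂ _+ᶻ_ (cong v first) rest ⟩
  v (f s) +ᶻ height f (suc s) n  ∎
  where
  open ≡-Reasoning
  first : b ≡ f s
  first = trans (w≗f F.zero) (cong f (ℕP.+-identityʳ s))
  rest : imbalance (toList w) ≡ height f (suc s) n
  rest = imbalance-toList w f (suc s) (λ i → trans (w≗f (F.suc i)) (cong f (ℕP.+-suc s (toℕ i))))

balanced⇒ : ∀ w → T (balancedᵇ w) → imbalance w ≡ 0ℤ
balanced⇒ w t rewrite ℕP.≡ᵇ⇒≡ (zeros w) (ones w) t = ℤP.n⊖n≡0 (ones w)

balanced⇐ : ∀ w → imbalance w ≡ 0ℤ → T (balancedᵇ w)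
balanced⇐ w i≡0 = ℕP.≡⇒≡ᵇ (zeros w) (ones w)
  (ℤP.+-injective (ℤP.i-j≡0⇒i≡j _ _ (trans (ℤP.m-n≡m⊖n (zeros w) (ones w)) i≡0)))

zeroDominated⇐ : ∀ w → 0ℤ <ᶻ imbalance w → T (zeroDomᵇ w)
zeroDominated⇐ w 0<i = ℕP.<⇒<ᵇ (ℕP.≰⇒> λ z≤o →
  ℤP.<⇒≱ 0<i (subst (imbalance w ≤ᶻ_) (ℤP.n⊖n≡0 (zeros w))
                (ℤP.⊖-monoʳ-≥-≤ (zeros w) {ones w} {zeros w} z≤o)))

zeros+ones : ∀ w → zeros w + ones w ≡ L.length w
zeros+ones []          = refl
zeros+ones (true ∷ w)  = trans (ℕP.+-suc (zeros w) (ones w)) (cong suc (zeros+ones w))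
zeros+ones (false ∷ w) = cong suc (zeros+ones w)

majority⇒negative : ∀ w → L.length w < 2 * ones w → imbalance w <ᶻ 0ℤ
majority⇒negative w majority =
  subst (imbalance w <ᶻ_) (ℤP.n⊖n≡0 (zeros w)) (ℤP.⊖-monoʳ->-< (zeros w) {ones w} {zeros w} zeros<ones)
  where
  zeros<ones : zeros w < ones w
  zeros<ones = ℕP.+-cancelʳ-< (ones w) (zeros w) (ones w)
    (subst₂ _<_ (sym (zeros+ones w)) (cong (ones w +_) (ℕP.+-identityʳ (ones w))) majority)

minBal⇒balanced : ∀ {n} (α : Tuple n) i L → T (minBalᵇ α i L) → height (at α) i L ≡ 0ℤ
minBal⇒balanced α i L t = trans (sym (imbalance-seg α i L)) (balanced⇒ (seg α i L) (proj₁ (Equivalence.to T-∧ t)))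

minBal⇐ : ∀ {n} (α : Tuple n) i e → Balanced (at α) i e → ZeroDominatedPrefixes (at α) i e →
          T (minBalᵇ α i (suc e))
minBal⇐ α i e balanced prefixes = Equivalence.from T-∧
  ( balanced⇐ (seg α i (suc e)) (trans (imbalance-seg α i (suc e)) balanced)
  , all⁻ _ (applyUpTo⁺₁ _ e (λ {l} l<e →
      zeroDominated⇐ (seg α i (suc l)) (subst (0ℤ <ᶻ_) (sym (imbalance-seg α i (suc l))) (prefixes l l<e)))))

connected⇒zero : ∀ {n} (α : Tuple n) i k → T (connectedᵇ α i k) → lookup α i ≡ false
connected⇒zero α i k c = Equivalence.to T-not-≡ (proj₁ (Equivalence.to T-∧ c))

connected⇒balanced : ∀ {n} (α : Tuple n) i k → T (connectedᵇ α i k) →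
                     height (at α) (toℕ i) (segLen n (toℕ i) (toℕ k)) ≡ 0ℤ
connected⇒balanced {n} α i k c = minBal⇒balanced α (toℕ i) (segLen n (toℕ i) (toℕ k))
  (proj₂ (Equivalence.to (T-∧ {lookup α k}) (proj₂ (Equivalence.to (T-∧ {not (lookup α i)}) c))))

connected⇐ : ∀ {n} (α : Tuple n) i k e → lookup α i ≡ false → lookup α k ≡ true →
             segLen n (toℕ i) (toℕ k) ≡ suc e →
             Balanced (at α) (toℕ i) e → ZeroDominatedPrefixes (at α) (toℕ i) e → T (connectedᵇ α i k)
connected⇐ α i k e αi≡0 αk≡1 length balanced prefixes rewrite αi≡0 | αk≡1 | length =
  minBal⇐ α (toℕ i) e balanced prefixes

-- An unbound one is a one to which no zero is connected (a one is never
-- connected to a later component, since connections start with a zero).  It is a one …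
unboundOne⇒one : ∀ {n} (α : Tuple n) k → T (unboundOneᵇ α k) → lookup α k ≡ true
unboundOne⇒one α k u = Equivalence.to T-≡ (proj₁ (Equivalence.to T-∧ u))

unboundOne⇒free : ∀ {n} (α : Tuple n) k → T (unboundOneᵇ α k) → ∀ j → ¬ T (connectedᵇ α j k)
unboundOne⇒free {n} α k u j c = T-not-elim _ (proj₂ (Equivalence.to T-∧ u)) bound
  where
  bound : T (boundᵇ α k)
  bound = any⁺ _ (Any.map (λ { refl → Equivalence.from T-∨ (inj₂ c) }) (∈-allFin j))

unboundOne⇐ : ∀ {n} (α : Tuple n) k → lookup α k ≡ true → (∀ j → ¬ T (connectedᵇ α j k)) →
              T (unboundOneᵇ α k)
unboundOne⇐ {n} α k αk≡1 free = Equivalence.from T-∧ (Equivalence.from T-≡ αk≡1 , T-not-intro _ unbound)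
  where
  unbound : ¬ T (boundᵇ α k)
  unbound bound with Any.satisfied (any⁻ _ (allFin n) bound)
  ... | j , c with Equivalence.to T-∨ c
  ...   | inj₁ k→j = subst T (connected⇒zero α k j k→j) (subst T (sym αk≡1) _)
  ...   | inj₂ j→k = free j j→k

lastUnboundOne⇒unboundOne : ∀ {n} (α : Tuple n) p → T (lastUnboundOneᵇ α p) → T (unboundOneᵇ α p)
lastUnboundOne⇒unboundOne α p t = proj₁ (Equivalence.to T-∧ t)

lastUnboundOne⇒last : ∀ {n} (α : Tuple n) p → T (lastUnboundOneᵇ α p) →
                      ∀ j → toℕ p < toℕ j → ¬ T (unboundOneᵇ α j)
lastUnboundOne⇒last {n} α p t j p<j u =
  T-not-elim _ (All.lookup (all⁺ _ (allFin n) (proj₂ (Equivalence.to (T-∧ {unboundOneᵇ α p}) t))) (∈-allFin j))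
    (Equivalence.from T-∧ (ℕP.<⇒<ᵇ p<j , u))

lastUnboundOne⇐ : ∀ {n} (α : Tuple n) p → T (unboundOneᵇ α p) →
                  (∀ j → toℕ p < toℕ j → ¬ T (unboundOneᵇ α j)) → T (lastUnboundOneᵇ α p)
lastUnboundOne⇐ {n} α p u later = Equivalence.from T-∧ (u , all⁻ _ {allFin n} (All.tabulate (λ {j} _ →
  T-not-intro _ (λ c → let p<ᵇj , uj = Equivalence.to (T-∧ {toℕ p ℕ.<ᵇ toℕ j}) c
                       in later j (ℕP.<ᵇ⇒< (toℕ p) (toℕ j) p<ᵇj) uj))))

lastUnboundOne-unique : ∀ {n} (α : Tuple n) p k → T (lastUnboundOneᵇ α p) → T (lastUnboundOneᵇ α k) → k ≡ p
lastUnboundOne-unique α p k tp tk with ℕP.<-cmp (toℕ p) (toℕ k)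
... | tri< p<k _ _ = ⊥-elim (lastUnboundOne⇒last α p tp k p<k (lastUnboundOne⇒unboundOne α k tk))
... | tri≈ _ p≡k _ = FP.toℕ-injective (sym p≡k)
... | tri> _ _ k<p = ⊥-elim (lastUnboundOne⇒last α k tk p k<p (lastUnboundOne⇒unboundOne α p tp))

D-clears : ∀ {n} (α : Tuple n) p → T (lastUnboundOneᵇ α p) → lookup (D α) p ≡ false
D-clears α p t rewrite lookup∘tabulate (λ k → lookup α k ∧ not (lastUnboundOneᵇ α k)) p
                     | Equivalence.to T-≡ t = ∧-zeroʳ (lookup α p)

D-keeps : ∀ {n} (α : Tuple n) p k → T (lastUnboundOneᵇ α p) → k ≢ p → lookup (D α) k ≡ lookup α k
D-keeps α p k t k≢p rewrite lookup∘tabulate (λ k → lookup α k ∧ not (lastUnboundOneᵇ α k)) k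
  with lastUnboundOneᵇ α k in last-k
... | true  = ⊥-elim (k≢p (lastUnboundOne-unique α p k t (subst T (sym last-k) _)))
... | false = ∧-identityʳ (lookup α k)

same-removal : ∀ {n} (α′ α″ : Tuple n) p → T (lastUnboundOneᵇ α′ p) → T (lastUnboundOneᵇ α″ p) →
               D α′ ≡ D α″ → α′ ≡ α″
same-removal α′ α″ p last′ last″ same = begin
  α′                    ≡⟨ sym (tabulate∘lookup α′) ⟩
  tabulate (lookup α′)  ≡⟨ tabulate-cong agree ⟩
  tabulate (lookup α″)  ≡⟨ tabulate∘lookup α″ ⟩
  α″                    ∎
  where
  open ≡-Reasoning
  agree : ∀ k → lookup α′ k ≡ lookup α″ k
  agree k with k FP.≟ p
  ... | yes refl = trans (unboundOne⇒one α′ p (lastUnboundOne⇒unboundOne α′ p last′))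
                         (sym (unboundOne⇒one α″ p (lastUnboundOne⇒unboundOne α″ p last″)))
  ... | no  k≢p  = trans (sym (D-keeps α′ p k last′ k≢p))
                         (trans (cong (λ w → lookup w k) same) (D-keeps α″ p k last″ k≢p))

other-removal-zero : ∀ {n} (α′ α″ : Tuple n) p q → T (lastUnboundOneᵇ α′ p) → T (lastUnboundOneᵇ α″ q) →
                     p ≢ q → D α′ ≡ D α″ → lookup α″ p ≡ false
other-removal-zero α′ α″ p q last′ last″ p≢q same =
  trans (sym (D-keeps α″ q p last″ p≢q)) (trans (sym (cong (λ w → lookup w p) same)) (D-clears α′ p last′))

other-removal-agree : ∀ {n} (α′ α″ : Tuple n) p q → T (lastUnboundOneᵇ α′ p) → T (lastUnboundOneᵇ α″ q) →
                      D α′ ≡ D α″ → ∀ k → k ≢ p → k ≢ q → lookup α′ k ≡ lookup α″ k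
other-removal-agree α′ α″ p q last′ last″ same k k≢p k≢q =
  trans (sym (D-keeps α′ p k last′ k≢p)) (trans (cong (λ w → lookup w k) same) (D-keeps α″ q k last″ k≢q))

first-minimum : (g : ℕ → ℤ) (M : ℕ) →
  ∃ λ t → t ≤ M × (∀ t′ → t′ ≤ M → g t ≤ᶻ g t′) × (∀ t′ → t′ < t → g t <ᶻ g t′)
first-minimum g zero = 0 , z≤n , (λ { zero z≤n → ℤP.≤-refl }) , (λ _ ())
first-minimum g (suc M) with first-minimum g M
... | t , t≤M , minimal , first with g (suc M) ℤP.<? g t
...   | yes new = suc M , ℕP.≤-refl , minimal′ , first′
  where
  minimal′ : ∀ t′ → t′ ≤ suc M → g (suc M) ≤ᶻ g t′
  minimal′ t′ t′≤1+M with ℕP.m≤n⇒m<n∨m≡n t′≤1+M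
  ... | inj₁ t′<1+M = ℤP.≤-trans (ℤP.<⇒≤ new) (minimal t′ (ℕ.s≤s⁻¹ t′<1+M))
  ... | inj₂ refl   = ℤP.≤-refl
  first′ : ∀ t′ → t′ < suc M → g (suc M) <ᶻ g t′
  first′ t′ t′<1+M = ℤP.<-≤-trans new (minimal t′ (ℕ.s≤s⁻¹ t′<1+M))
...   | no  old = t , ℕP.m≤n⇒m≤1+n t≤M , minimal′ , first
  where
  minimal′ : ∀ t′ → t′ ≤ suc M → g t ≤ᶻ g t′
  minimal′ t′ t′≤1+M with ℕP.m≤n⇒m<n∨m≡n t′≤1+M
  ... | inj₁ t′<1+M = minimal t′ (ℕ.s≤s⁻¹ t′<1+M)
  ... | inj₂ refl   = ℤP.≮⇒≥ old

largest : ∀ {n} (P : Fin n → Bool) k → T (P k) → ∃ λ p → T (P p) × (∀ j → toℕ p < toℕ j → ¬ T (P j))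
largest {suc n} P k Pk with FP.any? (λ i → T? (P (F.suc i)))
... | yes (i , Pi) = shift (largest (P ∘ F.suc) i Pi)
  where
  shift : (∃ λ p → T (P (F.suc p)) × (∀ j → toℕ p < toℕ j → ¬ T (P (F.suc j)))) →
          ∃ λ p → T (P p) × (∀ j → toℕ p < toℕ j → ¬ T (P j))
  shift (p , Pp , above) = F.suc p , Pp , λ { (F.suc j) (s<s p<j) → above j p<j }
... | no none = F.zero , P0 k Pk , later
  where
  P0 : ∀ k → T (P k) → T (P F.zero)
  P0 F.zero    Pk = Pk
  P0 (F.suc i) Pi = ⊥-elim (none (i , Pi))
  later : ∀ j → 0 < toℕ j → ¬ T (P j)
  later (F.suc j) _ Pj = none (j , Pj)

module _ {m : ℕ} where
  private
    N : ℕ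
    N = suc m

  at-lookup : (α : Tuple N) (i : Fin N) → at α (toℕ i) ≡ lookup α i
  at-lookup α i = cong (lookup α)
    (trans (FP.fromℕ<-cong _ _ (m<n⇒m%n≡m (FP.toℕ<n i)) _ (FP.toℕ<n i)) (FP.fromℕ<-toℕ i _))

  at-periodic : (α : Tuple N) (x : ℕ) → at α (x + N) ≡ at α x
  at-periodic α x = cong (lookup α) (FP.fromℕ<-cong _ _ ([m+n]%n≡m%n x N) _ _)

  height-periodic : (α : Tuple N) (x L : ℕ) → height (at α) (x + N) L ≡ height (at α) x L
  height-periodic α x L = height-cong (at α) (at α) (x + N) x L
    (λ k _ → trans (cong (at α) (+-right-comm x N k)) (at-periodic α (x + k)))

  -- Moving the start of a full turn by one position: the letter leaving at the
  -- front re-enters at the back.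
  height-turn-step : (α : Tuple N) (x : ℕ) → height (at α) x N ≡ height (at α) (suc x) N
  height-turn-step α x = begin
    v (at α x) +ᶻ height (at α) (suc x) m                ≡⟨ ℤP.+-comm (v (at α x)) _ ⟩
    height (at α) (suc x) m +ᶻ v (at α x)                ≡⟨ cong (λ b → height (at α) (suc x) m +ᶻ v b) wraps ⟩
    height (at α) (suc x) m +ᶻ v (at α (suc x + m))      ≡⟨ sym (height-snoc (at α) (suc x) m) ⟩
    height (at α) (suc x) N                              ∎
    where
    open ≡-Reasoning
    wraps : at α x ≡ at α (suc x + m)
    wraps = trans (sym (at-periodic α x)) (cong (at α) (ℕP.+-suc x m))

  height-turn : (α : Tuple N) (x : ℕ) → height (at α) x N ≡ height (at α) 0 N
  height-turn α zero    = refl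
  height-turn α (suc x) = trans (sym (height-turn-step α x)) (height-turn α x)

  turn-negative : (α : Tuple N) → InBplus α → ∀ x → height (at α) x N <ᶻ 0ℤ
  turn-negative α inB x = subst (_<ᶻ 0ℤ) (trans whole (sym (height-turn α x)))
    (majority⇒negative (toList α) (subst (_< 2 * ones (toList α)) (sym (length-toList α)) inB))
    where
    whole : imbalance (toList α) ≡ height (at α) 0 N
    whole = imbalance-toList α (at α) 0 (λ i → sym (at-lookup α i))

  -- The
  -- segments are taken to end at the copy k + N of k, so that wrapping ones start at
  -- a position of the tuple and the others at a copy of one.
  OneDominatedBefore : Tuple N → ℕ → Set
  OneDominatedBefore α k = ∀ s r → s + r ≡ k + N → r < N → height (at α) s (suc r) <ᶻ 0ℤ

  segLen-exact : ∀ i k e → e < N → (i + e ≡ k ⊎ i + e ≡ k + N) → segLen N i k ≡ suc e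
  segLen-exact i _ e e<N (inj₁ refl) = cong suc (begin
    (i + e + N ∸ i) % N    ≡⟨ cong (λ x → (x ∸ i) % N) (ℕP.+-assoc i e N) ⟩
    (i + (e + N) ∸ i) % N  ≡⟨ cong (_% N) (ℕP.m+n∸m≡n i (e + N)) ⟩
    (e + N) % N            ≡⟨ [m+n]%n≡m%n e N ⟩
    e % N                  ≡⟨ m<n⇒m%n≡m e<N ⟩
    e                      ∎)
    where open ≡-Reasoning
  segLen-exact i k e e<N (inj₂ i+e≡k+N) = cong suc (begin
    (k + N ∸ i) % N  ≡⟨ cong (λ x → (x ∸ i) % N) (sym i+e≡k+N) ⟩
    (i + e ∸ i) % N  ≡⟨ cong (_% N) (ℕP.m+n∸m≡n i e) ⟩
    e % N            ≡⟨ m<n⇒m%n≡m e<N ⟩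
    e                ∎)
    where open ≡-Reasoning

  segLen-distance : ∀ i k → i < N → k < N →
    ∃ λ e → e < N × segLen N i k ≡ suc e × (i + e ≡ k ⊎ i + e ≡ k + N)
  segLen-distance i k i<N k<N with i ℕ.≤? k
  ... | yes i≤k = k ∸ i , e<N , segLen-exact i k _ e<N reach , reach
    where
    reach = inj₁ (ℕP.m+[n∸m]≡n i≤k)
    e<N = ℕP.≤-<-trans (ℕP.m∸n≤m k i) k<N
  ... | no  i≰k = k + N ∸ i , e<N , segLen-exact i k _ e<N reach , reach
    where
    i+e≡k+N : i + (k + N ∸ i) ≡ k + N
    i+e≡k+N = ℕP.m+[n∸m]≡n (ℕP.≤-trans (ℕP.<⇒≤ i<N) (ℕP.m≤n+m N k))
    reach = inj₂ i+e≡k+N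
    e<N = ℕP.+-cancelˡ-< i _ N (subst (_< i + N) (sym i+e≡k+N) (ℕP.+-monoˡ-< N (ℕP.≰⇒> i≰k)))

  segment-start : (α : Tuple N) (y e k : ℕ) → k < N → y + e ≡ k + N →
    ∃ λ (i : Fin N) → (∀ L → height (at α) y L ≡ height (at α) (toℕ i) L) ×
                      (toℕ i + e ≡ k ⊎ toℕ i + e ≡ k + N)
  segment-start α y e k k<N y+e≡k+N with y ℕ.<? N
  ... | yes y<N = fromℕ< y<N , (λ L → cong (λ x → height (at α) x L) (sym i≡y)) ,
                  inj₂ (trans (cong (_+ e) i≡y) y+e≡k+N)
    where i≡y = FP.toℕ-fromℕ< y<N
  ... | no  y≮N with ℕP.m≤n⇒∃[o]m+o≡n (ℕP.≮⇒≥ y≮N)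
  ...   | o , refl = fromℕ< o<N , same , inj₁ (trans (cong (_+ e) i≡o) o+e≡k)
    where
    o+e≡k : o + e ≡ k
    o+e≡k = ℕP.+-cancelʳ-≡ N (o + e) k (trans (+-right-comm o e N) (trans (cong (_+ e) (ℕP.+-comm o N)) y+e≡k+N))
    o<N : o < N
    o<N = ℕP.≤-<-trans (subst (o ≤_) o+e≡k (ℕP.m≤m+n o e)) k<N
    i≡o : toℕ (fromℕ< o<N) ≡ o
    i≡o = FP.toℕ-fromℕ< o<N
    same : ∀ L → height (at α) (N + o) L ≡ height (at α) (toℕ (fromℕ< o<N)) L
    same L = trans (cong (λ x → height (at α) x L) (ℕP.+-comm N o))
                   (trans (height-periodic α o L) (cong (λ x → height (at α) x L) (sym i≡o)))

  -- Unbound ones are exactly the ones before which every segment is 1-dominated.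
  -- One direction: a zero connected to the one at k would start a balanced segment
  -- ending at k.
  oneDominated⇒unboundOne : (α : Tuple N) (k : Fin N) → lookup α k ≡ true →
                            OneDominatedBefore α (toℕ k) → T (unboundOneᵇ α k)
  oneDominated⇒unboundOne α k αk≡1 dominated = unboundOne⇐ α k αk≡1 free
    where
    free : ∀ j → ¬ T (connectedᵇ α j k)
    free j c with segLen-distance (toℕ j) (toℕ k) (FP.toℕ<n j) (FP.toℕ<n k)
    ... | e , e<N , length , reach = ℤP.<-irrefl balanced (negative reach)
      where
      balanced : height (at α) (toℕ j) (suc e) ≡ 0ℤ
      balanced = subst (λ L → height (at α) (toℕ j) L ≡ 0ℤ) length (connected⇒balanced α j k c)
      negative : (toℕ j + e ≡ toℕ k ⊎ toℕ j + e ≡ toℕ k + N) → height (at α) (toℕ j) (suc e) <ᶻ 0ℤ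
      negative (inj₁ j+e≡k)   = subst (_<ᶻ 0ℤ) (height-periodic α (toℕ j) (suc e))
        (dominated (toℕ j + N) e (trans (+-right-comm (toℕ j) N e) (cong (_+ N) j+e≡k)) e<N)
      negative (inj₂ j+e≡k+N) = dominated (toℕ j) e j+e≡k+N e<N

  -- The other direction, scanning backward from an unbound one: a segment ending
  -- there that is not 1-dominated would contain a minimal balanced segment
  -- connecting a zero to it.
  unboundOne⇒oneDominated : (α : Tuple N) (k : Fin N) → T (unboundOneᵇ α k) → OneDominatedBefore α (toℕ k)
  unboundOne⇒oneDominated α k unbound s r s+r≡k+N r<N =
    backward-scan (at α) (toℕ k + N) m one-at-k no-connection s r s+r≡k+N (ℕ.s≤s⁻¹ r<N)
    where
    αk≡1 : lookup α k ≡ true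
    αk≡1 = unboundOne⇒one α k unbound
    one-at-k : at α (toℕ k + N) ≡ true
    one-at-k = trans (at-periodic α (toℕ k)) (trans (at-lookup α k) αk≡1)
    no-connection : ∀ y e → y + e ≡ toℕ k + N → e ≤ m →
                    Balanced (at α) y e → OneDominatedSuffixes (at α) y e → ⊥
    no-connection y zero    _ _ balanced _ = letter-unbalanced (at α y) balanced
    no-connection y (suc t) y+e≡k+N e≤m balanced suffixes
      with segment-start α y (suc t) (toℕ k) (FP.toℕ<n k) y+e≡k+N
    ... | i , same , reach =
      unboundOne⇒free α k unbound i (connected⇐ α i k (suc t) αi≡0 αk≡1
        (segLen-exact (toℕ i) (toℕ k) (suc t) (s≤s e≤m) reach) balanced′ prefixes′)
      where
      balanced′ : Balanced (at α) (toℕ i) (suc t)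
      balanced′ = trans (sym (same (suc (suc t)))) balanced
      prefixes′ : ZeroDominatedPrefixes (at α) (toℕ i) (suc t)
      prefixes′ l l<e = subst (0ℤ <ᶻ_) (same (suc l))
        (suffixes⇒prefixes {at α} {y} {suc t} balanced suffixes l l<e)
      αi≡0 : lookup α i ≡ false
      αi≡0 = trans (sym (at-lookup α i)) (starts-with-zero {at α} {toℕ i} {t} prefixes′)

  -- The last letter of the first lowest prefix of α is an unbound one; such a
  -- prefix is nonempty since a full turn of α lowers the height.
  unboundOne-exists : (α : Tuple N) → InBplus α → ∃ λ k → T (unboundOneᵇ α k)
  unboundOne-exists α inB with first-minimum (height (at α) 0) N
  ... | zero  , _   , minimal , _     = ⊥-elim (ℤP.<⇒≱ (turn-negative α inB 0) (minimal N ℕP.≤-refl))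
  ... | suc k , k<N , minimal , first =
    fromℕ< k<N , oneDominated⇒unboundOne α (fromℕ< k<N) αk≡1
                   (subst (OneDominatedBefore α) (sym (FP.toℕ-fromℕ< k<N)) dominated)
    where
    g : ℕ → ℤ
    g = height (at α) 0
    αk≡1 : lookup α (fromℕ< k<N) ≡ true
    αk≡1 = trans (sym (at-lookup α _)) (trans (cong (at α) (FP.toℕ-fromℕ< k<N))
             (letter-lowers (g k) (at α k) (subst (_<ᶻ g k) (height-snoc (at α) 0 k) (first k ℕP.≤-refl))))
    -- A segment starting at s in the first turn is the rest of that turn followed by
    -- the first k + 1 letters; its height is (g N − g s) + g (k + 1) ≤ g N < 0.
    within-first-turn : ∀ s r → s + r ≡ k + N → s ≤ N → height (at α) s (suc r) <ᶻ 0ℤ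
    within-first-turn s r s+r≡k+N s≤N with ℕP.m≤n⇒∃[o]m+o≡n s≤N
    ... | a , s+a≡N = subst (_<ᶻ 0ℤ) (sym split) (ℤP.≤-<-trans bound (turn-negative α inB 0))
      where
      r≡a+k : r ≡ a + k
      r≡a+k = ℕP.+-cancelˡ-≡ s r (a + k) (trans s+r≡k+N (trans (cong (k +_) (sym s+a≡N)) (solve k s a)))
        where solve : ∀ k s a → k + (s + a) ≡ s + (a + k)
              solve = solve-∀
      split : height (at α) s (suc r) ≡ height (at α) s a +ᶻ g (suc k)
      split = begin
        height (at α) s (suc r)
          ≡⟨ cong (λ x → height (at α) s (suc x)) r≡a+k ⟩
        height (at α) s (suc (a + k))
          ≡⟨ cong (height (at α) s) (sym (ℕP.+-suc a k)) ⟩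
        height (at α) s (a + suc k)
          ≡⟨ height-++ (at α) s a (suc k) ⟩
        height (at α) s a +ᶻ height (at α) (s + a) (suc k)
          ≡⟨ cong (λ x → height (at α) s a +ᶻ height (at α) x (suc k)) s+a≡N ⟩
        height (at α) s a +ᶻ height (at α) (0 + N) (suc k)
          ≡⟨ cong (height (at α) s a +ᶻ_) (height-periodic α 0 (suc k)) ⟩
        height (at α) s a +ᶻ g (suc k)
          ∎
        where open ≡-Reasoning
      turn : g N ≡ g s +ᶻ height (at α) s a
      turn = trans (cong g (sym s+a≡N)) (height-++ (at α) 0 s a)
      bound : height (at α) s a +ᶻ g (suc k) ≤ᶻ g N
      bound = subst (height (at α) s a +ᶻ g (suc k) ≤ᶻ_) (trans (ℤP.+-comm _ (g s)) (sym turn))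
                (ℤP.+-monoʳ-≤ (height (at α) s a) (minimal s s≤N))
    -- A segment starting in the second turn is a copy of one ending at k, which
    -- lowers the height since k + 1 is the first lowest prefix.
    within-second-turn : ∀ s r → s + r ≡ k + N → N < s → height (at α) s (suc r) <ᶻ 0ℤ
    within-second-turn s r s+r≡k+N N<s with ℕP.m≤n⇒∃[o]m+o≡n (ℕP.<⇒≤ N<s)
    ... | o , refl = subst (_<ᶻ 0ℤ) (sym copy) (drop⇒negative (g o) _ (subst (_<ᶻ g o) split (first o o<1+k)))
      where
      o+r≡k : o + r ≡ k
      o+r≡k = ℕP.+-cancelʳ-≡ N (o + r) k (trans (+-right-comm o r N) (trans (cong (_+ r) (ℕP.+-comm o N)) s+r≡k+N))
      o<1+k : o < suc k
      o<1+k = s≤s (subst (o ≤_) o+r≡k (ℕP.m≤m+n o r))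
      copy : height (at α) (N + o) (suc r) ≡ height (at α) o (suc r)
      copy = trans (cong (λ x → height (at α) x (suc r)) (ℕP.+-comm N o)) (height-periodic α o (suc r))
      split : g (suc k) ≡ g o +ᶻ height (at α) o (suc r)
      split = trans (cong g (trans (cong suc (sym o+r≡k)) (sym (ℕP.+-suc o r)))) (height-++ (at α) 0 o (suc r))
    dominated : OneDominatedBefore α k
    dominated s r s+r≡k+N _ with s ℕ.≤? N
    ... | yes s≤N = within-first-turn s r s+r≡k+N s≤N
    ... | no  s≰N = within-second-turn s r s+r≡k+N (ℕP.≰⇒> s≰N)

  lastUnboundOne-exists : (α : Tuple N) → InBplus α → ∃ λ p → T (lastUnboundOneᵇ α p)
  lastUnboundOne-exists α inB with unboundOne-exists α inB
  ... | k , unbound-k with largest (unboundOneᵇ α) k unbound-k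
  ...   | p , unbound-p , above = p , lastUnboundOne⇐ α p unbound-p above

  -- If every segment ending at p is 1-dominated, and so is every segment ending at
  -- p + t that starts after p, then every segment ending at p + t is 1-dominated:
  -- a segment reaching back to p splits into one ending at p and the part after p.
  oneDominated-extend : (α : Tuple N) (p t : ℕ) → OneDominatedBefore α p →
                        OneDominatedSuffixes (at α) p t → OneDominatedBefore α (p + t)
  oneDominated-extend α p t before after s r s+r≡ r<N with s ℕ.≤? p + N
  ... | yes s≤p+N = reaching-back s r s+r≡ r<N s≤p+N
    where
    reaching-back : ∀ s r → s + r ≡ p + t + N → r < N → s ≤ p + N → height (at α) s (suc r) <ᶻ 0ℤ
    reaching-back s r s+r≡ r<N s≤p+N with ℕP.m≤n⇒∃[o]m+o≡n s≤p+N
    ... | a , s+a≡p+N = subst (_<ᶻ 0ℤ) (sym split) (ℤP.+-mono-<-≤ up-to-p rest)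
      where
      r≡a+t : r ≡ a + t
      r≡a+t = ℕP.+-cancelˡ-≡ s r (a + t) (begin
        s + r        ≡⟨ s+r≡ ⟩
        p + t + N    ≡⟨ +-right-comm p t N ⟩
        p + N + t    ≡⟨ cong (_+ t) (sym s+a≡p+N) ⟩
        s + a + t    ≡⟨ ℕP.+-assoc s a t ⟩
        s + (a + t)  ∎)
        where open ≡-Reasoning
      split : height (at α) s (suc r) ≡ height (at α) s (suc a) +ᶻ height (at α) (suc p + N) t
      split = trans (cong (λ x → height (at α) s (suc x)) r≡a+t)
                (trans (height-++ (at α) s (suc a) t)
                  (cong (λ x → height (at α) s (suc a) +ᶻ height (at α) x t)
                        (trans (ℕP.+-suc s a) (cong suc s+a≡p+N))))
      up-to-p : height (at α) s (suc a) <ᶻ 0ℤ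
      up-to-p = before s a s+a≡p+N (ℕP.≤-<-trans (subst (a ≤_) (sym r≡a+t) (ℕP.m≤m+n a t)) r<N)
      rest : height (at α) (suc p + N) t ≤ᶻ 0ℤ
      rest = subst (_≤ᶻ 0ℤ) (sym (height-periodic α (suc p) t)) (after-first-letter after)
  ... | no  s≰p+N = starting-after s r s+r≡ (ℕP.≰⇒> s≰p+N)
    where
    starting-after : ∀ s r → s + r ≡ p + t + N → p + N < s → height (at α) s (suc r) <ᶻ 0ℤ
    starting-after s r s+r≡ p+N<s with ℕP.m≤n⇒∃[o]m+o≡n p+N<s
    ... | b , refl = subst (_<ᶻ 0ℤ) (sym copy) (after b r b+1+r≡t)
      where
      b+1+r≡t : b + suc r ≡ t
      b+1+r≡t = ℕP.+-cancelˡ-≡ p _ _ (ℕP.+-cancelʳ-≡ N _ _ (trans (rearrange p N b r) s+r≡))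
        where rearrange : ∀ p N b r → p + (b + suc r) + N ≡ suc (p + N) + b + r
              rearrange = solve-∀
      copy : height (at α) (suc (p + N) + b) (suc r) ≡ height (at α) (p + suc b) (suc r)
      copy = trans (cong (λ x → height (at α) x (suc r)) (rearrange p N b)) (height-periodic α (p + suc b) (suc r))
        where rearrange : ∀ p N b → suc (p + N) + b ≡ p + suc b + N
              rearrange = solve-∀

  -- A segment starting at p with 0-dominated prefixes stops before any position q > p
  -- before which every segment is 1-dominated: otherwise the segment from p to q,
  -- a 0-dominated prefix followed by one letter, would not be 1-dominated.
  stops-before : (α : Tuple N) (p q t : ℕ) → p < q → q < N → OneDominatedBefore α q →
                 ZeroDominatedPrefixes (at α) p (suc t) → p + suc t < q
  stops-before α p q t p<q q<N before prefixes with p + suc t ℕ.<? q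
  ... | yes stops = stops
  ... | no  p+1+t≮q with proper-cut p<q
  ...   | l , refl = ⊥-elim (ℤP.<⇒≱ reaching-q (subst (0ℤ ≤ᶻ_) (sym (height-snoc (at α) p (suc l)))
                       (append-to-positive _ _ (prefixes l (ℕP.+-cancelˡ-≤ p (suc l) (suc t) (ℕP.≮⇒≥ p+1+t≮q))))))
    where
    reaching-q : height (at α) p (suc (suc l)) <ᶻ 0ℤ
    reaching-q = subst (_<ᶻ 0ℤ) (height-periodic α p (suc (suc l)))
      (before (p + N) (suc l) (+-right-comm p N (suc l)) (ℕP.≤-<-trans (ℕP.m≤n+m (suc l) p) q<N))

  -- Let α′ have its last unbound one at p and α″ an unbound one at q > p, with a zero
  -- at p, the two tuples agreeing strictly between p and q.  Scanning α″ forward from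
  -- p, a full turn is reached without balancing (impossible in B₊) unless the zero at
  -- p is connected to a one at some j with p < j < q.  Then in α′ every segment ending
  -- at j is 1-dominated: those starting after p are read in α″, the others pass
  -- through the unbound one p.  So j would be a later unbound one of α′.
  no-crossing : (α′ α″ : Tuple N) (p q : Fin N) → toℕ p < toℕ q → lookup α″ p ≡ false →
                (∀ y → toℕ p < y → y < toℕ q → at α′ y ≡ at α″ y) →
                T (lastUnboundOneᵇ α′ p) → T (unboundOneᵇ α″ q) → InBplus α″ → ⊥
  no-crossing α′ α″ p q p<q α″p≡0 agree last′ unbound″ inB″ =
    ℤP.<-asym (turn-negative α″ inB″ (toℕ p))
      (forward-scan (at α″) (toℕ p) m (trans (at-lookup α″ p) α″p≡0) connected-before-q m ℕP.≤-refl)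
    where
    connected-before-q : ∀ j → j ≤ m → Balanced (at α″) (toℕ p) j →
                         ZeroDominatedPrefixes (at α″) (toℕ p) j → ⊥
    connected-before-q zero    _ balanced _ = letter-unbalanced (at α″ (toℕ p)) balanced
    connected-before-q (suc t) _ balanced prefixes =
      lastUnboundOne⇒last α′ p last′ j p<j (oneDominated⇒unboundOne α′ j one′ dominated′)
      where
      j<q : toℕ p + suc t < toℕ q
      j<q = stops-before α″ (toℕ p) (toℕ q) t p<q (FP.toℕ<n q)
              (unboundOne⇒oneDominated α″ q unbound″) prefixes
      j<N : toℕ p + suc t < N
      j<N = ℕP.<-trans j<q (FP.toℕ<n q)
      j : Fin N
      j = fromℕ< j<N
      j≡ : toℕ j ≡ toℕ p + suc t
      j≡ = FP.toℕ-fromℕ< j<N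
      p<j : toℕ p < toℕ j
      p<j = subst (toℕ p <_) (sym j≡) (ℕP.m<m+n (toℕ p) z<s)
      suffixes′ : OneDominatedSuffixes (at α′) (toℕ p) (suc t)
      suffixes′ = suffixes-transfer (at α″) (at α′) (toℕ p) (suc t)
        (λ y p<y y≤j → sym (agree y p<y (ℕP.≤-<-trans y≤j j<q)))
        (prefixes⇒suffixes {at α″} {toℕ p} {suc t} balanced prefixes)
      one′ : lookup α′ j ≡ true
      one′ = trans (sym (at-lookup α′ j)) (trans (cong (at α′) j≡) (ends-with-one {at α′} {toℕ p} {t} suffixes′))
      dominated′ : OneDominatedBefore α′ (toℕ j)
      dominated′ = subst (OneDominatedBefore α′) (sym j≡)
        (oneDominated-extend α′ (toℕ p) (suc t)
          (unboundOne⇒oneDominated α′ p (lastUnboundOne⇒unboundOne α′ p last′)) suffixes′)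

  crossing-impossible : (α′ α″ : Tuple N) (p q : Fin N) → T (lastUnboundOneᵇ α′ p) →
                        T (lastUnboundOneᵇ α″ q) → toℕ p < toℕ q → D α′ ≡ D α″ → InBplus α″ → ⊥
  crossing-impossible α′ α″ p q last′ last″ p<q same inB″ =
    no-crossing α′ α″ p q p<q (other-removal-zero α′ α″ p q last′ last″ p≢q same) agree last′
      (lastUnboundOne⇒unboundOne α″ q last″) inB″
    where
    p≢q : p ≢ q
    p≢q refl = ℕP.<-irrefl refl p<q
    agree : ∀ y → toℕ p < y → y < toℕ q → at α′ y ≡ at α″ y
    agree y p<y y<q = begin
      at α′ y         ≡⟨ cong (at α′) (sym k≡y) ⟩
      at α′ (toℕ k)   ≡⟨ at-lookup α′ k ⟩
      lookup α′ k     ≡⟨ other-removal-agree α′ α″ p q last′ last″ same k k≢p k≢q ⟩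
      lookup α″ k     ≡⟨ sym (at-lookup α″ k) ⟩
      at α″ (toℕ k)   ≡⟨ cong (at α″) k≡y ⟩
      at α″ y         ∎
      where
      open ≡-Reasoning
      y<N : y < N
      y<N = ℕP.<-trans y<q (FP.toℕ<n q)
      k : Fin N
      k = fromℕ< y<N
      k≡y : toℕ k ≡ y
      k≡y = FP.toℕ-fromℕ< y<N
      k≢p : k ≢ p
      k≢p k≡p = ℕP.<-irrefl (trans (cong toℕ (sym k≡p)) k≡y) p<y
      k≢q : k ≢ q
      k≢q k≡q = ℕP.<-irrefl (trans (sym k≡y) (cong toℕ k≡q)) y<q

-- Two tuples with the same image either clear
-- the same position, and then coincide, or clear positions p < q (after possibly
-- swapping them), which is impossible.
lemma3 : (n : ℕ) (α′ α″ : Tuple n) → InBplus α′ → InBplus α″ →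
    α′ ≢ α″ → D α′ ≢ D α″
lemma3 zero V.[] V.[] () _ _ _
lemma3 (suc m) α′ α″ inB′ inB″ α′≢α″ same
  with lastUnboundOne-exists α′ inB′ | lastUnboundOne-exists α″ inB″
... | p , last′ | q , last″ with ℕP.<-cmp (toℕ p) (toℕ q)
...   | tri< p<q _ _ = crossing-impossible α′ α″ p q last′ last″ p<q same inB″
...   | tri> _ _ q<p = crossing-impossible α″ α′ q p last″ last′ q<p (sym same) inB′
...   | tri≈ _ p≡q _ = α′≢α″ (same-removal α′ α″ p last′ last″′ same)
  where
  last″′ : T (lastUnboundOneᵇ α″ p)
  last″′ = subst (T ∘ lastUnboundOneᵇ α″) (sym (FP.toℕ-injective p≡q)) last″
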